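{- Let $k\ge1$, let $(\varphi_j)_{j\ge0}$ be non-negative numbers with $\varphi_0>0$, and for $n\ge1$ let $T_n=\sum_{T\in\mathcal{O}(n)}\big(\prod_{v\in T}\varphi_{\mathrm{outdeg}(v)}\big)\,|\mathcal{L}^{[k]}(T)|$, where $|\mathcal{L}^{[k]}(T)|$ is the number of increasing $k$-labellings of $T$ with label set $\{1,\dots,kn\}$. Then \[\sum_{T\in\mathcal{O}(n)}\prod_{v\in T}\left(\frac{\varphi_{\mathrm{outdeg}(v)}}{(kh_v)^{\underline{k}}}\right)=\frac{T_n}{(kn)!}.\]
   Context: $\mathcal{O}(n)$ is the set of ordered (planted plane) rooted trees with $n$ nodes; $\mathrm{outdeg}(v)$ is the number of children of $v$; $h_v$ is the number of descendants of $v$ including $v$. An increasing $k$-labelling of a tree with $n$ nodes assigns to each node a set of exactly $k$ integers from $\{1,\dots,kn\}$, these sets partitioning $\{1,\dots,kn\}$, such that every label of a child is larger than every label of its parent. $x^{\underline{s}}=x(x-1)\cdots(x-s+1)$.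
   Formalization: The non-negative numbers $(\varphi_j)_{j\ge0}$ are taken to be rationals. -}

module Defs where

open import Data.Nat as ℕ using (ℕ; zero; suc; _<_; pred)
open import Data.Nat using (_!)
open import Data.Integer using (+_)
open import Data.Rational using (ℚ; 0ℚ; 1ℚ; _/_) renaming (_+_ to _+ℚ_; _*_ to _*ℚ_)
open import Data.List using (List; []; _∷_; _++_; length; map; upTo)
open import Data.List.Relation.Unary.All using (All)
open import Data.List.Relation.Unary.AllPairs using (AllPairs)
open import Data.List.Relation.Binary.Permutation.Propositional using (_↭_)
open import Data.List.Membership.Propositional using (_∈_)
open import Data.Vec using (Vec; toList)

data Tree : Set where
  node : List Tree → Tree

mutual
  -- number of nodes (h_v for the root v of the tree)
  size : Tree → ℕ
  size (node cs) = suc (sizeF cs)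

  sizeF : List Tree → ℕ
  sizeF [] = 0
  sizeF (t ∷ ts) = size t ℕ.+ sizeF ts

falling : ℕ → ℕ → ℕ
falling x zero = 1
falling x (suc s) = x ℕ.* falling (pred x) s

-- reciprocal of a natural number in ℚ (only ever applied to nonzero numbers;
-- the value at 0 is an irrelevant convention)
inv : ℕ → ℚ
inv zero = 0ℚ
inv (suc n) = + 1 / suc n

fromℕ : ℕ → ℚ
fromℕ n = + n / 1

sumℚ : List ℚ → ℚ
sumℚ [] = 0ℚ
sumℚ (x ∷ xs) = x +ℚ sumℚ xs

module _ (k : ℕ) (φ : ℕ → ℚ) where
  mutual
    hookWeight : Tree → ℚ
    hookWeight (node cs) =
      (φ (length cs) *ℚ inv (falling (k ℕ.* size (node cs)) k)) *ℚ hookWeightF cs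

    hookWeightF : List Tree → ℚ
    hookWeightF [] = 1ℚ
    hookWeightF (t ∷ ts) = hookWeight t *ℚ hookWeightF ts

  mutual
    weight : Tree → ℚ
    weight (node cs) = φ (length cs) *ℚ weightF cs

    weightF : List Tree → ℚ
    weightF [] = 1ℚ
    weightF (t ∷ ts) = weight t *ℚ weightF ts

-- Trees whose nodes carry a k-element set of naturals, represented canonically
-- as a strictly increasing vector of length k.
data LTree (k : ℕ) : Set where
  lnode : Vec ℕ k → List (LTree k) → LTree k

module _ {k : ℕ} where
  rootLabel : LTree k → Vec ℕ k
  rootLabel (lnode v _) = v

  mutual
    shape : LTree k → Tree
    shape (lnode _ cs) = node (shapeF cs)

    shapeF : List (LTree k) → List Tree
    shapeF [] = []
    shapeF (c ∷ cs) = shape c ∷ shapeF cs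

  mutual
    labels : LTree k → List ℕ
    labels (lnode v cs) = toList v ++ labelsF cs

    labelsF : List (LTree k) → List ℕ
    labelsF [] = []
    labelsF (c ∷ cs) = labels c ++ labelsF cs

  data Increasing : LTree k → Set where
    inc : ∀ {v cs} →
          AllPairs _<_ (toList v) →
          All (λ c → ∀ a b → a ∈ toList v → b ∈ toList (rootLabel c) → a < b) cs →
          All Increasing cs →
          Increasing (lnode v cs)

IsIncLabelling : (k : ℕ) → Tree → LTree k → Set
IsIncLabelling k T ℓ =
  (shape ℓ ≡ T) × Increasing ℓ × (labels ℓ ↭ map suc (upTo (k ℕ.* size T)))
  where
    open import Relation.Binary.PropositionalEquality using (_≡_)
    open import Data.Product using (_×_)

{-# OPTIONS --safe #-}
-- Give the labels as a strictly increasing list S. An increasing k-labelling of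
-- node [T₁, …, T_r] must put the k smallest labels of S on the root; the remaining labels are
-- split freely into blocks of sizes k|T₁|, …, k|T_r|, each labelling its subtree increasingly.
-- This recursion enumerates the labellings without repetition, so their number is a product
-- of binomial coefficients. Since C(a + b, a) a! b! = (a + b)! and (kh)^{\underline k} (kh - k)! = (kh)!,
-- that product equals (kn)! / ∏_v (k h_v)^{\underline k} (the hook length formula), and
-- multiplying by the weight of each tree gives the theorem.
module Submission where

open import Defs
open import Data.Nat using (ℕ; _≤_; _*_; _!)
open import Data.Rational using (ℚ; 0ℚ) renaming (_≤_ to _≤ℚ_; _<_ to _<ℚ_; _*_ to _*ℚ_)
open import Data.List using (List; map; length)
open import Data.List.Membership.Propositional using (_∈_)
open import Data.List.Relation.Unary.Unique.Propositional using (Unique)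
open import Data.Product using (_×_)
open import Relation.Binary.PropositionalEquality using (_≡_)

open import Algebra.Bundles using (CommutativeMonoid)
import Algebra.Properties.CommutativeSemigroup as CommSemigroupProperties
open import Data.Empty using (⊥; ⊥-elim)
open import Data.Integer using (+_)
open import Data.List using ([]; _∷_; [_]; _++_; concatMap; cartesianProductWith; upTo)
open import Data.List.Membership.Propositional using (find; lose)
open import Data.List.Membership.Propositional.Properties
  using (∈-++⁺ˡ; ∈-++⁺ʳ; ∈-++⁻; ∈-∃++; ∈-map⁺; ∈-map⁻; ∈-concatMap⁺; ∈-concatMap⁻;
         ∈-cartesianProductWith⁺; ∈-cartesianProductWith⁻)
open import Data.List.Membership.Propositional.Properties.WithK using (unique∧set⇒bag)
open import Data.List.Properties using (length-++; length-map; length-upTo; ∷-injective)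
open import Data.List.Relation.Binary.BagAndSetEquality using (_∼[_]_; set; ∼bag⇒↭)
open import Data.List.Relation.Binary.Equality.Propositional using (≋⇒≡)
open import Data.List.Relation.Binary.Permutation.Propositional
  using (_↭_; ↭-refl; ↭-sym; ↭-trans; prep; ↭⇒↭ₛ)
open import Data.List.Relation.Binary.Permutation.Propositional.Properties
  using (↭-empty-inv; ∈-resp-↭; ↭-length; ++⁺ˡ; ++⁺ʳ; ++⁺; shift; drop-∷)
open import Data.List.Relation.Unary.All as All using (All; []; _∷_)
import Data.List.Relation.Unary.All.Properties as Allₚ
open import Data.List.Relation.Unary.AllPairs as AllPairs using (AllPairs; []; _∷_)
import Data.List.Relation.Unary.AllPairs.Properties as AllPairsₚ
open import Data.List.Relation.Unary.Any using (here; there)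
open import Data.List.Relation.Unary.Linked using (Linked)
open import Data.List.Relation.Unary.Linked.Properties using (AllPairs⇒Linked)
open import Data.List.Relation.Unary.Sorted.TotalOrder.Properties using (↗↭↗⇒≋)
import Data.List.Relation.Unary.Unique.Propositional.Properties as Uniqueₚ
open import Data.Maybe as Maybe using (Maybe; just; nothing)
open import Data.Nat using (zero; suc; _+_; _∸_; _<_; s<s; NonZero)
open import Data.Nat.Combinatorics using (_C_; nCk+nC[k+1]≡[n+1]C[k+1]; nCk≡n!/k![n-k]!; k![n∸k]!∣n!)
open import Data.Nat.DivMod using (_/_; m/n*n≡m)
open import Data.Nat.Properties
  using (<-trans; <-asym; <⇒≤; <⇒≢; ≤-totalOrder; suc-injective; +-identityʳ; +-cancelˡ-≡;
         *-assoc; *-suc; *-zeroʳ; *-distribˡ-+; m+n∸m≡n; m≤m+n; m*n≢0⇒m≢0; _!≢0; _!*_!≢0;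
         *-commutativeSemigroup)
open import Data.Product using (_,_; proj₁; proj₂; ∃; ∃₂)
open import Data.Rational using (1ℚ; fromℚᵘ; toℚᵘ) renaming (_+_ to _+ℚ_)
import Data.Rational.Properties as ℚ
open import Data.Rational.Properties using (fromℚᵘ-cong; fromℚᵘ-toℚᵘ; toℚᵘ-fromℚᵘ; toℚᵘ-homo-*)
open import Data.Rational.Unnormalised as ℚᵘ using (mkℚᵘ)
import Data.Rational.Unnormalised.Properties as ℚᵘ
open import Data.Sum using (_⊎_; inj₁; inj₂)
open import Data.Vec using (Vec; []; _∷_; toList)
open import Data.Vec.Properties using (length-toList)
open import Function using (_∘_; id; mk⇔)
open import Relation.Binary.PropositionalEquality
  using (refl; sym; trans; cong; cong₂; subst; module ≡-Reasoning)

module ℕₚ = CommSemigroupProperties *-commutativeSemigroup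
module ℚₚ = CommSemigroupProperties (CommutativeMonoid.commutativeSemigroup ℚ.*-1-commutativeMonoid)

private variable
  A B D : Set

length-cartesianProductWith : (f : A → B → D) (xs : List A) (ys : List B) →
  length (cartesianProductWith f xs ys) ≡ length xs * length ys
length-cartesianProductWith f [] ys = refl
length-cartesianProductWith f (x ∷ xs) ys = trans (length-++ (map (f x) ys))
  (cong₂ _+_ (length-map (f x) ys) (length-cartesianProductWith f xs ys))

length-concatMap-const : (f : A → List B) (xs : List A) {c : ℕ} →
  (∀ {x} → x ∈ xs → length (f x) ≡ c) → length (concatMap f xs) ≡ length xs * c
length-concatMap-const f [] _ = refl
length-concatMap-const f (x ∷ xs) |f| = trans (length-++ (f x))
  (cong₂ _+_ (|f| (here refl)) (length-concatMap-const f xs (|f| ∘ there)))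

Unique-concatMap⁺ : (f : A → List B) {xs : List A} → Unique xs → (∀ {x} → x ∈ xs → Unique (f x)) →
  (∀ {x y z} → x ∈ xs → y ∈ xs → z ∈ f x → z ∈ f y → x ≡ y) → Unique (concatMap f xs)
Unique-concatMap⁺ f {[]} _ _ _ = []
Unique-concatMap⁺ f {x ∷ xs} (x∉xs ∷ xs!) f! disjoint = Uniqueₚ.++⁺
  (f! (here refl))
  (Unique-concatMap⁺ f xs! (f! ∘ there) (λ x∈ y∈ → disjoint (there x∈) (there y∈)))
  λ (z∈fx , z∈rest) → let (y , y∈xs , z∈fy) = find (∈-concatMap⁻ f {xs = xs} z∈rest) in
    All.lookup x∉xs y∈xs (disjoint (here refl) (there y∈xs) z∈fx z∈fy)

unique∧set⇒length≡ : {xs ys : List A} → Unique xs → Unique ys → xs ∼[ set ] ys →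
  length xs ≡ length ys
unique∧set⇒length≡ xs! ys! xs≈ys = ↭-length (∼bag⇒↭ (unique∧set⇒bag xs! ys! xs≈ys))

∈⇒↭∷ : {x : A} {xs : List A} → x ∈ xs → ∃ λ ys → xs ↭ x ∷ ys
∈⇒↭∷ {x = x} x∈xs with ys₁ , ys₂ , refl ← ∈-∃++ x∈xs = ys₁ ++ ys₂ , shift x ys₁ ys₂

AllPairs-++⁻ : {R : A → A → Set} (xs : List A) {ys : List A} → AllPairs R (xs ++ ys) →
  AllPairs R xs × AllPairs R ys × (∀ {a b} → a ∈ xs → b ∈ ys → R a b)
AllPairs-++⁻ [] Rys = [] , Rys , λ ()
AllPairs-++⁻ (x ∷ xs) (Rx ∷ Rxsys) with Rxs , Rys , Rxs-ys ← AllPairs-++⁻ xs Rxsys =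
  Allₚ.++⁻ˡ xs Rx ∷ Rxs , Rys , λ where
    (here refl) b∈ys → All.lookup (Allₚ.++⁻ʳ xs Rx) b∈ys
    (there a∈xs) b∈ys → Rxs-ys a∈xs b∈ys

sameLength-inhabited : ∀ {n a} {v w : Vec A n} → a ∈ toList v → ∃ λ b → b ∈ toList w
sameLength-inhabited {v = []} {w = []} ()
sameLength-inhabited {w = b ∷ _} _ = b , here refl

StrictlySorted : List ℕ → Set
StrictlySorted = AllPairs _<_

strictlySorted⇒unique : {xs : List ℕ} → StrictlySorted xs → Unique xs
strictlySorted⇒unique = AllPairs.map <⇒≢

strictlySorted-↭⇒≡ : {xs ys : List ℕ} → StrictlySorted xs → StrictlySorted ys → xs ↭ ys → xs ≡ ys
strictlySorted-↭⇒≡ xs↗ ys↗ xs↭ys = ≋⇒≡ (↗↭↗⇒≋ ≤-totalOrder (linked xs↗) (linked ys↗) (↭⇒↭ₛ xs↭ys))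
  where
  linked : {zs : List ℕ} → StrictlySorted zs → Linked _≤_ zs
  linked = AllPairs⇒Linked ∘ AllPairs.map <⇒≤

least-head-↭ : {x s : ℕ} {xs S : List ℕ} → All (x <_) xs → All (s <_) S → x ∷ xs ↭ s ∷ S → x ≡ s
least-head-↭ x<xs s<S x∷xs↭s∷S
  with ∈-resp-↭ (↭-sym x∷xs↭s∷S) (here refl) | ∈-resp-↭ x∷xs↭s∷S (here refl)
... | here s≡x   | _          = sym s≡x
... | there _    | here x≡s   = x≡s
... | there s∈xs | there x∈S = ⊥-elim (<-asym (All.lookup x<xs s∈xs) (All.lookup s<S x∈S))

strictlySorted-prefix : {X Y S : List ℕ} → StrictlySorted S → StrictlySorted X →
  (∀ {a b} → a ∈ X → b ∈ Y → a < b) → X ++ Y ↭ S → ∃ λ R → S ≡ X ++ R × Y ↭ R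
strictlySorted-prefix {[]} {Y} {S} _ _ _ Y↭S = S , refl , Y↭S
strictlySorted-prefix {_ ∷ _} {Y} {[]} _ _ _ X++Y↭[] with () ← ↭-empty-inv X++Y↭[]
strictlySorted-prefix {x ∷ X} {Y} {s ∷ S} (s<S ∷ S↗) (x<X ∷ X↗) X<Y X++Y↭S
  with refl ← least-head-↭ (Allₚ.++⁺ x<X (All.tabulate (X<Y (here refl)))) s<S X++Y↭S
  with R , refl , Y↭R ← strictlySorted-prefix S↗ X↗ (X<Y ∘ there) (drop-∷ X++Y↭S)
  = R , refl , Y↭R

Selection : Set → Set
Selection A = List A × List A

choose skip : A → Selection A → Selection A
choose s (X , Y) = s ∷ X , Y
skip s (X , Y) = X , s ∷ Y

selections : ℕ → List A → List (Selection A)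
selections zero S = [ [] , S ]
selections (suc m) [] = []
selections (suc m) (s ∷ S) = map (choose s) (selections m S) ++ map (skip s) (selections (suc m) S)

∈selections⁻ : ∀ m (s : A) S {p} → p ∈ selections (suc m) (s ∷ S) →
  (∃ λ q → q ∈ selections m S × p ≡ choose s q) ⊎ (∃ λ q → q ∈ selections (suc m) S × p ≡ skip s q)
∈selections⁻ m s S p∈ with ∈-++⁻ (map (choose s) (selections m S)) p∈
... | inj₁ p∈chosen  = inj₁ (∈-map⁻ (choose s) p∈chosen)
... | inj₂ p∈skipped = inj₂ (∈-map⁻ (skip s) p∈skipped)

∈selections⇒↭ : ∀ m (S : List A) {p} → p ∈ selections m S → proj₁ p ++ proj₂ p ↭ S
∈selections⇒↭ zero S (here refl) = ↭-refl
∈selections⇒↭ (suc m) (s ∷ S) p∈ with ∈selections⁻ m s S p∈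
... | inj₁ ((X , Y) , q∈ , refl) = prep s (∈selections⇒↭ m S q∈)
... | inj₂ ((X , Y) , q∈ , refl) = ↭-trans (shift s X Y) (prep s (∈selections⇒↭ (suc m) S q∈))

∈selections⇒length : ∀ m (S : List A) {p} → p ∈ selections m S → length (proj₁ p) ≡ m
∈selections⇒length zero S (here refl) = refl
∈selections⇒length (suc m) (s ∷ S) p∈ with ∈selections⁻ m s S p∈
... | inj₁ (q , q∈ , refl) = cong suc (∈selections⇒length m S q∈)
... | inj₂ (q , q∈ , refl) = ∈selections⇒length (suc m) S q∈

module _ (m : ℕ) (S : List A) {p : Selection A} (p∈ : p ∈ selections m S) where

  ∈selections⇒⊆₁ : ∀ {x} → x ∈ proj₁ p → x ∈ S
  ∈selections⇒⊆₁ = ∈-resp-↭ (∈selections⇒↭ m S p∈) ∘ ∈-++⁺ˡ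

  ∈selections⇒⊆₂ : ∀ {x} → x ∈ proj₂ p → x ∈ S
  ∈selections⇒⊆₂ = ∈-resp-↭ (∈selections⇒↭ m S p∈) ∘ ∈-++⁺ʳ (proj₁ p)

∈selections⇒strictlySorted : ∀ m {S p} → StrictlySorted S → p ∈ selections m S →
  StrictlySorted (proj₁ p) × StrictlySorted (proj₂ p)
∈selections⇒strictlySorted zero S↗ (here refl) = [] , S↗
∈selections⇒strictlySorted (suc m) {s ∷ S} (s<S ∷ S↗) p∈ with ∈selections⁻ m s S p∈
... | inj₁ (q , q∈ , refl) = let (X↗ , Y↗) = ∈selections⇒strictlySorted m S↗ q∈ in
  Allₚ.anti-mono (∈selections⇒⊆₁ m S q∈) s<S ∷ X↗ , Y↗
... | inj₂ (q , q∈ , refl) = let (X↗ , Y↗) = ∈selections⇒strictlySorted (suc m) S↗ q∈ in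
  X↗ , Allₚ.anti-mono (∈selections⇒⊆₂ (suc m) S q∈) s<S ∷ Y↗

selections-unique : ∀ m {S : List A} → Unique S → Unique (selections m S)
selections-unique zero _ = [] ∷ []
selections-unique (suc m) {[]} _ = []
selections-unique (suc m) {s ∷ S} (s∉S ∷ S!) = Uniqueₚ.++⁺
  (Uniqueₚ.map⁺ choose-injective (selections-unique m S!))
  (Uniqueₚ.map⁺ skip-injective (selections-unique (suc m) S!))
  λ (p∈chosen , p∈skipped) → chosen∉skipped (∈-map⁻ (choose s) p∈chosen) (∈-map⁻ (skip s) p∈skipped)
  where
  choose-injective : ∀ {p q} → choose s p ≡ choose s q → p ≡ q
  choose-injective refl = refl

  skip-injective : ∀ {p q} → skip s p ≡ skip s q → p ≡ q
  skip-injective refl = refl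

  chosen∉skipped : ∀ {p} → (∃ λ q → q ∈ selections m S × p ≡ choose s q) →
    (∃ λ r → r ∈ selections (suc m) S × p ≡ skip s r) → ⊥
  chosen∉skipped (_ , _ , refl) (r , r∈ , p≡skip) =
    All.lookup s∉S (∈selections⇒⊆₁ (suc m) S r∈ (subst (s ∈_) (cong proj₁ p≡skip) (here refl))) refl

∈selections⁺ : ∀ (X Y S : List A) → X ++ Y ↭ S →
  ∃ λ p → p ∈ selections (length X) S × X ↭ proj₁ p × Y ↭ proj₂ p
∈selections⁺ [] Y S Y↭S = ([] , S) , here refl , ↭-refl , Y↭S
∈selections⁺ (_ ∷ _) Y [] X++Y↭[] with () ← ↭-empty-inv X++Y↭[]
∈selections⁺ X@(_ ∷ _) Y (s ∷ S) X++Y↭s∷S with ∈-++⁻ X (∈-resp-↭ (↭-sym X++Y↭s∷S) (here refl))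
... | inj₁ s∈X
  with X′ , X↭s∷X′ ← ∈⇒↭∷ s∈X
  with p , p∈ , X′↭ , Y↭ ← ∈selections⁺ X′ Y S (drop-∷ (↭-trans (↭-sym (++⁺ʳ Y X↭s∷X′)) X++Y↭s∷S))
  = choose s p
  , subst (λ m → choose s p ∈ selections m (s ∷ S)) (sym (↭-length X↭s∷X′))
          (∈-++⁺ˡ (∈-map⁺ (choose s) p∈))
  , ↭-trans X↭s∷X′ (prep s X′↭)
  , Y↭
... | inj₂ s∈Y
  with Y′ , Y↭s∷Y′ ← ∈⇒↭∷ s∈Y
  with p , p∈ , X↭ , Y′↭ ← ∈selections⁺ X Y′ S
         (drop-∷ (↭-trans (↭-sym (↭-trans (++⁺ˡ X Y↭s∷Y′) (shift s X Y′))) X++Y↭s∷S))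
  = skip s p , ∈-++⁺ʳ _ (∈-map⁺ (skip s) p∈) , X↭ , ↭-trans Y↭s∷Y′ (prep s Y′↭)

length-selections : ∀ m (S : List A) → length (selections m S) ≡ length S C m
length-selections zero S = refl
length-selections (suc m) [] = refl
length-selections (suc m) (s ∷ S) = begin
  length (map (choose s) (selections m S) ++ map (skip s) (selections (suc m) S))
    ≡⟨ length-++ (map (choose s) (selections m S)) ⟩
  length (map (choose s) (selections m S)) + length (map (skip s) (selections (suc m) S))
    ≡⟨ cong₂ _+_ (trans (length-map (choose s) (selections m S)) (length-selections m S))
                 (trans (length-map (skip s) (selections (suc m) S)) (length-selections (suc m) S)) ⟩
  length S C m + length S C suc m
    ≡⟨ nCk+nC[k+1]≡[n+1]C[k+1] (length S) m ⟩
  suc (length S) C suc m ∎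
  where open ≡-Reasoning

takeVec : (j : ℕ) → List A → Maybe (Vec A j × List A)
takeVec zero S = just ([] , S)
takeVec (suc j) [] = nothing
takeVec (suc j) (s ∷ S) = Maybe.map (λ (v , R) → s ∷ v , R) (takeVec j S)

takeVec-++ : ∀ {j} (v : Vec A j) R → takeVec j (toList v ++ R) ≡ just (v , R)
takeVec-++ [] R = refl
takeVec-++ (x ∷ v) R = cong (Maybe.map (λ (v , R) → x ∷ v , R)) (takeVec-++ v R)

takeVec-just⇒++ : ∀ j (S : List A) {v R} → takeVec j S ≡ just (v , R) → S ≡ toList v ++ R
takeVec-just⇒++ zero S refl = refl
takeVec-just⇒++ (suc j) (s ∷ S) eq with takeVec j S in eq′
takeVec-just⇒++ (suc j) (s ∷ S) refl | just (v , R) = cong (s ∷_) (takeVec-just⇒++ j S eq′)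

takeVec-AllPairs : {R : A → A → Set} → ∀ j {S : List A} {v R′} → AllPairs R S →
  takeVec j S ≡ just (v , R′) →
  AllPairs R (toList v) × AllPairs R R′ × (∀ {a b} → a ∈ toList v → b ∈ R′ → R a b)
takeVec-AllPairs j {S} {v} RS eq =
  AllPairs-++⁻ (toList v) (subst (AllPairs _) (takeVec-just⇒++ j S eq) RS)

splitVec : ∀ j {n} (S : List A) → length S ≡ j + n →
  ∃₂ λ (v : Vec A j) R → S ≡ toList v ++ R × length R ≡ n
splitVec zero S |S| = [] , S , refl , |S|
splitVec (suc j) (s ∷ S) |S| with v , R , refl , |R| ← splitVec j S (suc-injective |S|) =
  s ∷ v , R , refl , |R|

falling-*-! : ∀ a b → falling (a + b) a * b ! ≡ (a + b) !
falling-*-! zero b = +-identityʳ (b !)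
falling-*-! (suc a) b =
  trans (*-assoc (suc (a + b)) (falling (a + b) a) (b !)) (cong (suc (a + b) *_) (falling-*-! a b))

C-*-!-*-! : ∀ a b → ((a + b) C a) * (a ! * b !) ≡ (a + b) !
C-*-!-*-! a b = begin
  ((a + b) C a) * (a ! * b !)
    ≡⟨ cong (λ c → ((a + b) C a) * (a ! * c !)) (m+n∸m≡n a b) ⟨
  ((a + b) C a) * (a ! * (a + b ∸ a) !)
    ≡⟨ cong (_* (a ! * (a + b ∸ a) !)) (nCk≡n!/k![n-k]! (m≤m+n a b)) ⟩
  (a + b) ! / (a ! * (a + b ∸ a) !) * (a ! * (a + b ∸ a) !)
    ≡⟨ m/n*n≡m (k![n∸k]!∣n! (m≤m+n a b)) ⟩
  (a + b) ! ∎
  where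
  open ≡-Reasoning
  instance _ = a !* (a + b ∸ a) !≢0

fromℚᵘ-homo-* : ∀ p q → fromℚᵘ (p ℚᵘ.* q) ≡ fromℚᵘ p *ℚ fromℚᵘ q
fromℚᵘ-homo-* p q = begin
  fromℚᵘ (p ℚᵘ.* q)
    ≡⟨ fromℚᵘ-cong (ℚᵘ.*-cong (ℚᵘ.≃-sym (toℚᵘ-fromℚᵘ p)) (ℚᵘ.≃-sym (toℚᵘ-fromℚᵘ q))) ⟩
  fromℚᵘ (toℚᵘ (fromℚᵘ p) ℚᵘ.* toℚᵘ (fromℚᵘ q))
    ≡⟨ fromℚᵘ-cong (toℚᵘ-homo-* (fromℚᵘ p) (fromℚᵘ q)) ⟨
  fromℚᵘ (toℚᵘ (fromℚᵘ p *ℚ fromℚᵘ q))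
    ≡⟨ fromℚᵘ-toℚᵘ (fromℚᵘ p *ℚ fromℚᵘ q) ⟩
  fromℚᵘ p *ℚ fromℚᵘ q ∎
  where open ≡-Reasoning

-- inv (suc n) is fromℚᵘ (mkℚᵘ (+ 1) n) by definition.
inv-* : ∀ m n → inv (m * n) ≡ inv m *ℚ inv n
inv-* zero n = sym (ℚ.*-zeroˡ (inv n))
inv-* (suc m) zero = trans (cong inv (*-zeroʳ m)) (sym (ℚ.*-zeroʳ (inv (suc m))))
inv-* (suc m) (suc n) = fromℚᵘ-homo-* (mkℚᵘ (+ 1) m) (mkℚᵘ (+ 1) n)

fromℕ-*-inv : ∀ n .{{_ : NonZero n}} → fromℕ n *ℚ inv n ≡ 1ℚ
fromℕ-*-inv (suc n) = trans (sym (fromℚᵘ-homo-* (mkℚᵘ (+ suc n) 0) (mkℚᵘ (+ 1) n)))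
  (fromℚᵘ-cong (ℚᵘ.*-inverseʳ (mkℚᵘ (+ suc n) 0)))

*-fromℕ-inv-cancel : ∀ w c h .{{_ : NonZero c}} → (w *ℚ fromℕ c) *ℚ inv (c * h) ≡ w *ℚ inv h
*-fromℕ-inv-cancel w c h = begin
  (w *ℚ fromℕ c) *ℚ inv (c * h)      ≡⟨ cong ((w *ℚ fromℕ c) *ℚ_) (inv-* c h) ⟩
  (w *ℚ fromℕ c) *ℚ (inv c *ℚ inv h) ≡⟨ ℚ.*-assoc w (fromℕ c) (inv c *ℚ inv h) ⟩
  w *ℚ (fromℕ c *ℚ (inv c *ℚ inv h)) ≡⟨ cong (w *ℚ_) (ℚ.*-assoc (fromℕ c) (inv c) (inv h)) ⟨
  w *ℚ ((fromℕ c *ℚ inv c) *ℚ inv h) ≡⟨ cong (λ x → w *ℚ (x *ℚ inv h)) (fromℕ-*-inv c) ⟩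
  w *ℚ (1ℚ *ℚ inv h)                 ≡⟨ cong (w *ℚ_) (ℚ.*-identityˡ (inv h)) ⟩
  w *ℚ inv h                         ∎
  where open ≡-Reasoning

*-inv-interchange : ∀ a b m n → (a *ℚ inv m) *ℚ (b *ℚ inv n) ≡ (a *ℚ b) *ℚ inv (m * n)
*-inv-interchange a b m n =
  trans (ℚₚ.interchange a (inv m) b (inv n)) (cong ((a *ℚ b) *ℚ_) (sym (inv-* m n)))

module _ (k : ℕ) where

  IsIncLabellingOn : List ℕ → Tree → LTree k → Set
  IsIncLabellingOn S T ℓ = shape ℓ ≡ T × Increasing ℓ × labels ℓ ↭ S

  IsIncForestLabellingOn : List ℕ → List Tree → List (LTree k) → Set
  IsIncForestLabellingOn S ts fs = shapeF fs ≡ ts × All Increasing fs × labelsF fs ↭ S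

  -- For sorted S, takeVec k S gives the root the k smallest labels.
  mutual
    labellings : Tree → List ℕ → List (LTree k)
    labellings (node ts) S with takeVec k S
    ... | nothing = []
    ... | just (v , R) = map (lnode v) (forestLabellings ts R)

    forestLabellings : List Tree → List ℕ → List (List (LTree k))
    forestLabellings [] [] = [ [] ]
    forestLabellings [] (_ ∷ _) = []
    forestLabellings (t ∷ ts) S = concatMap (consLabellings t ts) (selections (k * size t) S)

    consLabellings : Tree → List Tree → Selection ℕ → List (List (LTree k))
    consLabellings t ts (X , Y) = cartesianProductWith _∷_ (labellings t X) (forestLabellings ts Y)

  root∈labelsF : ∀ {c : LTree k} {fs b} → c ∈ fs → b ∈ toList (rootLabel c) → b ∈ labelsF fs
  root∈labelsF {lnode w gs} {_ ∷ _} (here refl) b∈w = ∈-++⁺ˡ (∈-++⁺ˡ b∈w)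
  root∈labelsF {fs = f ∷ _} (there c∈fs) b∈w = ∈-++⁺ʳ (labels f) (root∈labelsF c∈fs b∈w)

  mutual
    labellings-sound : ∀ T {S ℓ} → StrictlySorted S → ℓ ∈ labellings T S → IsIncLabellingOn S T ℓ
    labellings-sound (node ts) {S} S↗ ℓ∈ with takeVec k S in eq
    ... | just (v , R)
      with fs , fs∈ , refl ← ∈-map⁻ (lnode v) ℓ∈
      with v↗ , R↗ , v<R ← takeVec-AllPairs k S↗ eq
      with refl , fs-inc , fs↭R ← forestLabellings-sound ts R↗ fs∈
      = refl
      , inc v↗ (All.tabulate λ c∈fs _ _ a∈v b∈c → v<R a∈v (∈-resp-↭ fs↭R (root∈labelsF c∈fs b∈c)))
            fs-inc
      , subst (toList v ++ labelsF fs ↭_) (sym (takeVec-just⇒++ k S eq)) (++⁺ˡ (toList v) fs↭R)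

    forestLabellings-sound : ∀ ts {S fs} → StrictlySorted S → fs ∈ forestLabellings ts S →
      IsIncForestLabellingOn S ts fs
    forestLabellings-sound [] {[]} _ (here refl) = refl , [] , ↭-refl
    forestLabellings-sound (t ∷ ts) {S} S↗ fs∈
      with p@(X , Y) , p∈ , fs∈p ←
             find (∈-concatMap⁻ (consLabellings t ts) {xs = selections (k * size t) S} fs∈)
      with a , r , a∈ , r∈ , refl ←
             ∈-cartesianProductWith⁻ _∷_ (labellings t X) (forestLabellings ts Y) fs∈p
      with X↗ , Y↗ ← ∈selections⇒strictlySorted (k * size t) S↗ p∈
      with refl , a-inc , a↭X ← labellings-sound t X↗ a∈
      with refl , r-inc , r↭Y ← forestLabellings-sound ts Y↗ r∈
      = refl , a-inc ∷ r-inc , ↭-trans (++⁺ a↭X r↭Y) (∈selections⇒↭ (k * size t) S p∈)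

  lnode-injective : ∀ {v : Vec ℕ k} {fs gs} → lnode v fs ≡ lnode v gs → fs ≡ gs
  lnode-injective refl = refl

  mutual
    labellings-unique : ∀ T {S} → StrictlySorted S → Unique (labellings T S)
    labellings-unique (node ts) {S} S↗ with takeVec k S in eq
    ... | nothing = []
    ... | just (v , R) with _ , R↗ , _ ← takeVec-AllPairs k S↗ eq =
      Uniqueₚ.map⁺ lnode-injective (forestLabellings-unique ts R↗)

    forestLabellings-unique : ∀ ts {S} → StrictlySorted S → Unique (forestLabellings ts S)
    forestLabellings-unique [] {[]} _ = [] ∷ []
    forestLabellings-unique [] {_ ∷ _} _ = []
    forestLabellings-unique (t ∷ ts) {S} S↗ = Unique-concatMap⁺ (consLabellings t ts)
      (selections-unique m (strictlySorted⇒unique S↗)) cons-unique cons-disjoint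
      where
      m = k * size t

      cons-unique : ∀ {p} → p ∈ selections m S → Unique (consLabellings t ts p)
      cons-unique p∈ with X↗ , Y↗ ← ∈selections⇒strictlySorted m S↗ p∈ =
        Uniqueₚ.cartesianProductWith⁺ _∷_ ∷-injective
          (labellings-unique t X↗) (forestLabellings-unique ts Y↗)

      -- The label sets of the first tree and of the rest determine the selection, as both
      -- parts of a selection from a sorted list are sorted.
      cons-disjoint : ∀ {p q z} → p ∈ selections m S → q ∈ selections m S →
        z ∈ consLabellings t ts p → z ∈ consLabellings t ts q → p ≡ q
      cons-disjoint {X , Y} {X′ , Y′} p∈ q∈ z∈p z∈q
        with a , r , a∈ , r∈ , refl ←
               ∈-cartesianProductWith⁻ _∷_ (labellings t X) (forestLabellings ts Y) z∈p
        with _ , _ , a∈′ , r∈′ , refl ←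
               ∈-cartesianProductWith⁻ _∷_ (labellings t X′) (forestLabellings ts Y′) z∈q
        with X↗ , Y↗ ← ∈selections⇒strictlySorted m S↗ p∈
        with X′↗ , Y′↗ ← ∈selections⇒strictlySorted m S↗ q∈
        with _ , _ , a↭X ← labellings-sound t X↗ a∈
        with _ , _ , a↭X′ ← labellings-sound t X′↗ a∈′
        with _ , _ , r↭Y ← forestLabellings-sound ts Y↗ r∈
        with _ , _ , r↭Y′ ← forestLabellings-sound ts Y′↗ r∈′
        = cong₂ _,_ (strictlySorted-↭⇒≡ X↗ X′↗ (↭-trans (↭-sym a↭X) a↭X′))
                    (strictlySorted-↭⇒≡ Y↗ Y′↗ (↭-trans (↭-sym r↭Y) r↭Y′))

  root<descendants : ∀ {v : Vec ℕ k} {fs a b} → Increasing (lnode v fs) →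
    a ∈ toList v → b ∈ labelsF fs → a < b
  root<descendants {fs = lnode w gs ∷ fs} (inc v↗ (v<w ∷ v<roots) (c-inc ∷ fs-inc)) a∈v b∈
    with ∈-++⁻ (labels (lnode w gs)) b∈
  ... | inj₂ b∈fs = root<descendants (inc v↗ v<roots fs-inc) a∈v b∈fs
  ... | inj₁ b∈c with ∈-++⁻ (toList w) b∈c
  ...   | inj₁ b∈w = v<w _ _ a∈v b∈w
  ...   | inj₂ b∈gs with r , r∈w ← sameLength-inhabited {w = w} a∈v =
    <-trans (v<w _ _ a∈v r∈w) (root<descendants c-inc r∈w b∈gs)

  mutual
    length-labels : ∀ (ℓ : LTree k) → length (labels ℓ) ≡ k * size (shape ℓ)
    length-labels (lnode v fs) = begin
      length (toList v ++ labelsF fs)         ≡⟨ length-++ (toList v) ⟩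
      length (toList v) + length (labelsF fs) ≡⟨ cong₂ _+_ (length-toList v) (length-labelsF fs) ⟩
      k + k * sizeF (shapeF fs)               ≡⟨ *-suc k (sizeF (shapeF fs)) ⟨
      k * suc (sizeF (shapeF fs))             ∎
      where open ≡-Reasoning

    length-labelsF : ∀ (fs : List (LTree k)) → length (labelsF fs) ≡ k * sizeF (shapeF fs)
    length-labelsF [] = sym (*-zeroʳ k)
    length-labelsF (f ∷ fs) = begin
      length (labels f ++ labelsF fs)            ≡⟨ length-++ (labels f) ⟩
      length (labels f) + length (labelsF fs)    ≡⟨ cong₂ _+_ (length-labels f) (length-labelsF fs) ⟩
      k * size (shape f) + k * sizeF (shapeF fs) ≡⟨ *-distribˡ-+ k (size (shape f)) _ ⟨
      k * (size (shape f) + sizeF (shapeF fs))   ∎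
      where open ≡-Reasoning

  mutual
    labellings-complete : ∀ T {S ℓ} → StrictlySorted S → IsIncLabellingOn S T ℓ → ℓ ∈ labellings T S
    labellings-complete _ {S} {lnode v fs} S↗ (refl , ℓ-inc@(inc v↗ _ fs-inc) , v++fs↭S)
      with R , refl , fs↭R ← strictlySorted-prefix S↗ v↗ (root<descendants ℓ-inc) v++fs↭S
      with _ , R↗ , _ ← AllPairs-++⁻ (toList v) S↗
      rewrite takeVec-++ v R
      = ∈-map⁺ (lnode v) (forestLabellings-complete (shapeF fs) R↗ (refl , fs-inc , fs↭R))

    forestLabellings-complete : ∀ ts {S fs} → StrictlySorted S → IsIncForestLabellingOn S ts fs →
      fs ∈ forestLabellings ts S
    forestLabellings-complete _ {S} {[]} _ (refl , [] , []↭S)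
      with refl ← ↭-empty-inv (↭-sym []↭S) = here refl
    forestLabellings-complete _ {S} {f ∷ fs} S↗ (refl , f-inc ∷ fs-inc , f++fs↭S)
      with p , p∈ , f↭X , fs↭Y ← ∈selections⁺ (labels f) (labelsF fs) S f++fs↭S
      with p∈′ ← subst (λ m → p ∈ selections m S) (length-labels f) p∈
      with X↗ , Y↗ ← ∈selections⇒strictlySorted (k * size (shape f)) S↗ p∈′
      = ∈-concatMap⁺ (consLabellings (shape f) (shapeF fs)) (lose p∈′ (∈-cartesianProductWith⁺ _∷_
          (labellings-complete (shape f) X↗ (refl , f-inc , f↭X))
          (forestLabellings-complete (shapeF fs) Y↗ (refl , fs-inc , fs↭Y))))

  mutual
    labellingCount : Tree → ℕ
    labellingCount (node ts) = forestCount ts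

    forestCount : List Tree → ℕ
    forestCount [] = 1
    forestCount (t ∷ ts) = ((k * sizeF (t ∷ ts)) C (k * size t)) * (labellingCount t * forestCount ts)

  mutual
    length-labellings : ∀ T {S} → length S ≡ k * size T → length (labellings T S) ≡ labellingCount T
    length-labellings (node ts) {S} |S|
      with v , R , refl , |R| ← splitVec k S (trans |S| (*-suc k (sizeF ts)))
      rewrite takeVec-++ v R
      = trans (length-map (lnode v) (forestLabellings ts R)) (length-forestLabellings ts |R|)

    length-forestLabellings : ∀ ts {S} → length S ≡ k * sizeF ts →
      length (forestLabellings ts S) ≡ forestCount ts
    length-forestLabellings [] {[]} _ = refl
    length-forestLabellings [] {_ ∷ _} |S| with () ← trans |S| (*-zeroʳ k)
    length-forestLabellings (t ∷ ts) {S} |S| = begin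
      length (concatMap (consLabellings t ts) (selections m S))
        ≡⟨ length-concatMap-const (consLabellings t ts) (selections m S) length-cons ⟩
      length (selections m S) * (labellingCount t * forestCount ts)
        ≡⟨ cong (_* (labellingCount t * forestCount ts))
                (trans (length-selections m S) (cong (_C m) |S|)) ⟩
      ((k * sizeF (t ∷ ts)) C m) * (labellingCount t * forestCount ts) ∎
      where
      open ≡-Reasoning
      m = k * size t

      length-cons : ∀ {p} → p ∈ selections m S →
        length (consLabellings t ts p) ≡ labellingCount t * forestCount ts
      length-cons {X , Y} p∈ =
        trans (length-cartesianProductWith _∷_ (labellings t X) (forestLabellings ts Y))
              (cong₂ _*_ (length-labellings t |X|) (length-forestLabellings ts |Y|))
        where
        |X| : length X ≡ m
        |X| = ∈selections⇒length m S p∈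

        |Y| : length Y ≡ k * sizeF ts
        |Y| = +-cancelˡ-≡ m (length Y) (k * sizeF ts) (begin
          m + length Y            ≡⟨ cong (_+ length Y) |X| ⟨
          length X + length Y     ≡⟨ length-++ X ⟨
          length (X ++ Y)         ≡⟨ ↭-length (∈selections⇒↭ m S p∈) ⟩
          length S                ≡⟨ |S| ⟩
          k * (size t + sizeF ts) ≡⟨ *-distribˡ-+ k (size t) (sizeF ts) ⟩
          m + k * sizeF ts        ∎)

  length-enumeration : (L : Tree → List (LTree k)) → (∀ T → Unique (L T)) →
    (∀ T ℓ → (ℓ ∈ L T → IsIncLabelling k T ℓ) × (IsIncLabelling k T ℓ → ℓ ∈ L T)) →
    ∀ T → length (L T) ≡ labellingCount T
  length-enumeration L L! L-spec T = begin
    length (L T)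
      ≡⟨ unique∧set⇒length≡ (L! T) (labellings-unique T S↗)
           (mk⇔ (labellings-complete T S↗ ∘ proj₁ (L-spec T _))
                (proj₂ (L-spec T _) ∘ labellings-sound T S↗)) ⟩
    length (labellings T S)
      ≡⟨ length-labellings T (trans (length-map suc (upTo (k * size T))) (length-upTo (k * size T))) ⟩
    labellingCount T ∎
    where
    open ≡-Reasoning
    S = map suc (upTo (k * size T))
    S↗ : StrictlySorted S
    S↗ = AllPairsₚ.map⁺ (AllPairsₚ.applyUpTo⁺₁ id (k * size T) (λ i<j _ → s<s i<j))

  mutual
    hookProduct : Tree → ℕ
    hookProduct (node ts) = falling (k * size (node ts)) k * hookProductF ts

    hookProductF : List Tree → ℕ
    hookProductF [] = 1
    hookProductF (t ∷ ts) = hookProduct t * hookProductF ts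

  mutual
    labellingCount-*-hookProduct : ∀ T → labellingCount T * hookProduct T ≡ (k * size T) !
    labellingCount-*-hookProduct (node ts) = begin
      forestCount ts * (falling (k * suc n) k * hookProductF ts)
        ≡⟨ ℕₚ.x∙yz≈y∙xz (forestCount ts) (falling (k * suc n) k) (hookProductF ts) ⟩
      falling (k * suc n) k * (forestCount ts * hookProductF ts)
        ≡⟨ cong₂ (λ m c → falling m k * c) (*-suc k n) (forestCount-*-hookProductF ts) ⟩
      falling (k + k * n) k * (k * n) ! ≡⟨ falling-*-! k (k * n) ⟩
      (k + k * n) !                     ≡⟨ cong _! (*-suc k n) ⟨
      (k * suc n) !                     ∎
      where
      open ≡-Reasoning
      n = sizeF ts

    forestCount-*-hookProductF : ∀ ts → forestCount ts * hookProductF ts ≡ (k * sizeF ts) !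
    forestCount-*-hookProductF [] = cong _! (sym (*-zeroʳ k))
    forestCount-*-hookProductF (t ∷ ts) = begin
      (c * (labellingCount t * forestCount ts)) * (hookProduct t * hookProductF ts)
        ≡⟨ trans (*-assoc c _ _) (cong (c *_) (ℕₚ.interchange (labellingCount t) _ _ _)) ⟩
      c * ((labellingCount t * hookProduct t) * (forestCount ts * hookProductF ts))
        ≡⟨ cong (c *_) (cong₂ _*_ (labellingCount-*-hookProduct t) (forestCount-*-hookProductF ts)) ⟩
      c * (a ! * b !)
        ≡⟨ cong (λ m → (m C a) * (a ! * b !)) (*-distribˡ-+ k (size t) (sizeF ts)) ⟩
      ((a + b) C a) * (a ! * b !)
        ≡⟨ C-*-!-*-! a b ⟩
      (a + b) !
        ≡⟨ cong _! (*-distribˡ-+ k (size t) (sizeF ts)) ⟨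
      (k * (size t + sizeF ts)) ! ∎
      where
      open ≡-Reasoning
      a = k * size t
      b = k * sizeF ts
      c = (k * sizeF (t ∷ ts)) C a

  mutual
    hookWeight≡weight*inv-hookProduct : ∀ φ T → hookWeight k φ T ≡ weight k φ T *ℚ inv (hookProduct T)
    hookWeight≡weight*inv-hookProduct φ (node ts) = trans
      (cong (φ (length ts) *ℚ inv (falling (k * size (node ts)) k) *ℚ_)
            (hookWeightF≡weightF*inv-hookProductF φ ts))
      (*-inv-interchange (φ (length ts)) (weightF k φ ts)
                         (falling (k * size (node ts)) k) (hookProductF ts))

    hookWeightF≡weightF*inv-hookProductF : ∀ φ ts →
      hookWeightF k φ ts ≡ weightF k φ ts *ℚ inv (hookProductF ts)
    hookWeightF≡weightF*inv-hookProductF φ [] = sym (ℚ.*-identityʳ 1ℚ)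
    hookWeightF≡weightF*inv-hookProductF φ (t ∷ ts) = trans
      (cong₂ _*ℚ_ (hookWeight≡weight*inv-hookProduct φ t) (hookWeightF≡weightF*inv-hookProductF φ ts))
      (*-inv-interchange (weight k φ t) (weightF k φ ts) (hookProduct t) (hookProductF ts))

hookWeight≡weight*count/factorial : ∀ k φ (L : Tree → List (LTree k)) → (∀ T → Unique (L T)) →
  (∀ T ℓ → (ℓ ∈ L T → IsIncLabelling k T ℓ) × (IsIncLabelling k T ℓ → ℓ ∈ L T)) →
  ∀ T → hookWeight k φ T ≡ (weight k φ T *ℚ fromℕ (length (L T))) *ℚ inv ((k * size T) !)
hookWeight≡weight*count/factorial k φ L L! L-spec T = begin
  hookWeight k φ T
    ≡⟨ hookWeight≡weight*inv-hookProduct k φ T ⟩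
  weight k φ T *ℚ inv (hookProduct k T)
    ≡⟨ *-fromℕ-inv-cancel (weight k φ T) c (hookProduct k T) ⟨
  (weight k φ T *ℚ fromℕ c) *ℚ inv (c * hookProduct k T)
    ≡⟨ cong₂ (λ c′ m → (weight k φ T *ℚ fromℕ c′) *ℚ inv m)
             (sym (length-enumeration k L L! L-spec T)) c*h≡n! ⟩
  (weight k φ T *ℚ fromℕ (length (L T))) *ℚ inv ((k * size T) !) ∎
  where
  open ≡-Reasoning
  c = labellingCount k T

  c*h≡n! : c * hookProduct k T ≡ (k * size T) !
  c*h≡n! = labellingCount-*-hookProduct k T

  instance
    c≢0 : NonZero c
    c≢0 = m*n≢0⇒m≢0 c {{subst NonZero (sym c*h≡n!) ((k * size T) !≢0)}}

sumℚ-map-cong : {f g : A → ℚ} (xs : List A) → (∀ {x} → x ∈ xs → f x ≡ g x) →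
  sumℚ (map f xs) ≡ sumℚ (map g xs)
sumℚ-map-cong [] _ = refl
sumℚ-map-cong (x ∷ xs) f≡g = cong₂ _+ℚ_ (f≡g (here refl)) (sumℚ-map-cong xs (f≡g ∘ there))

sumℚ-map-*ʳ : (f : A → ℚ) (c : ℚ) (xs : List A) →
  sumℚ (map f xs) *ℚ c ≡ sumℚ (map (λ x → f x *ℚ c) xs)
sumℚ-map-*ʳ f c [] = ℚ.*-zeroˡ c
sumℚ-map-*ʳ f c (x ∷ xs) = trans (ℚ.*-distribʳ-+ c (f x) _) (cong (f x *ℚ c +ℚ_) (sumℚ-map-*ʳ f c xs))

theorem6p2 : (k : ℕ) → 1 ≤ k →
    (φ : ℕ → ℚ) → (∀ j → 0ℚ ≤ℚ φ j) → 0ℚ <ℚ φ 0 →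
    (n : ℕ) → 1 ≤ n →
    -- O enumerates 𝒪(n) without repetition
    (O : List Tree) → Unique O →
    (∀ T → (T ∈ O → size T ≡ n) × (size T ≡ n → T ∈ O)) →
    -- L T enumerates the increasing k-labellings of T without repetition
    (L : Tree → List (LTree k)) → (∀ T → Unique (L T)) →
    (∀ T ℓ → (ℓ ∈ L T → IsIncLabelling k T ℓ) × (IsIncLabelling k T ℓ → ℓ ∈ L T)) →
    sumℚ (map (hookWeight k φ) O)
      ≡ sumℚ (map (λ T → weight k φ T *ℚ fromℕ (length (L T))) O) *ℚ inv ((k * n) !)
theorem6p2 k _ φ _ _ n _ O _ O-spec L L! L-spec = begin
  sumℚ (map (hookWeight k φ) O)
    ≡⟨ sumℚ-map-cong O hookWeight≡ ⟩
  sumℚ (map (λ T → (weight k φ T *ℚ fromℕ (length (L T))) *ℚ inv ((k * n) !)) O)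
    ≡⟨ sumℚ-map-*ʳ (λ T → weight k φ T *ℚ fromℕ (length (L T))) (inv ((k * n) !)) O ⟨
  sumℚ (map (λ T → weight k φ T *ℚ fromℕ (length (L T))) O) *ℚ inv ((k * n) !) ∎
  where
  open ≡-Reasoning
  hookWeight≡ : ∀ {T} → T ∈ O →
    hookWeight k φ T ≡ (weight k φ T *ℚ fromℕ (length (L T))) *ℚ inv ((k * n) !)
  hookWeight≡ {T} T∈O =
    subst (λ m → hookWeight k φ T ≡ (weight k φ T *ℚ fromℕ (length (L T))) *ℚ inv ((k * m) !))
          (proj₁ (O-spec T) T∈O) (hookWeight≡weight*count/factorial k φ L L! L-spec T)
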